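{- Let $X\subseteq\mathbb{N}^2$ be standardization-invariant. Let $I=\{i_1<i_2<\cdots<i_k\}\subseteq[n-1]$, set $i_0=0$, and let $n\ge\max(I)$. Then \[ d_X(I;n)=\sum_{\{j_1<\cdots<j_r\}\subseteq\{1,\dots,k\}}(-1)^{k-r}\binom{n}{i_{j_r}}\binom{i_{j_r}}{i_{j_{r-1}}}\cdots\binom{i_{j_2}}{i_{j_1}}\prod_{t=0}^{r} d_X\bigl(\emptyset;\,i_{j_{t+1}}-i_{j_t}\bigr), \] where $j_0=0$, $j_{r+1}=k+1$, $i_{k+1}=n$; when $r=0$ the (empty) product of binomial coefficients is $1$ and the last product is $d_X(\emptyset;n)$.
   Context: $[n]=\{1,\dots,n\}$. For finite $S\subseteq\mathbb{N}$ with $|S|=n$, $\mathfrak{S}_S$ is the set of bijections $\pi:[n]\to S$ in one-line notation $\pi_1\cdots\pi_n$; $\mathrm{XDes}(\pi)=\{i\in[n-1]:(\pi_i,\pi_{i+1})\in X\}$; $d_X(I;S)$ is the number of $\pi\in\mathfrak{S}_S$ with $\mathrm{XDes}(\pi)=I$, and $d_X(I;n)=d_X(I;[n])$. $X$ is standardization-invariant if for every finite $S\subseteq\mathbb{N}$ and every $I$, $d_X(I;S)$ depends only on $|S|$ (so $d_X(I;S)=d_X(I;|S|)$). -}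

module Defs where

open import Data.Bool using (Bool; if_then_else_)
open import Data.Nat using (ℕ; zero; suc; _∸_; _*_; _≤_; _<_)
open import Data.Nat.Combinatorics using (_C_)
open import Data.Integer as ℤ using (ℤ; +_; -1ℤ)
open import Data.List using (List; []; _∷_; map; concatMap; filter; length; upTo; foldr)
open import Data.List.Properties using (≡-dec)
open import Data.List.Relation.Unary.Unique.Propositional using (Unique)
open import Relation.Binary.PropositionalEquality using (_≡_)
import Data.Nat as ℕ

Rel2 : Set
Rel2 = ℕ → ℕ → Bool

range : ℕ → List ℕ
range n = map suc (upTo n)

insertions : ℕ → List ℕ → List (List ℕ)
insertions x []       = (x ∷ []) ∷ []
insertions x (y ∷ ys) = (x ∷ y ∷ ys) ∷ map (y ∷_) (insertions x ys)

-- all orderings (one-line notations) of the elements of a list;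
-- for a duplicate-free list S this is 𝔖_S, each element exactly once
perms : List ℕ → List (List ℕ)
perms []       = [] ∷ []
perms (x ∷ xs) = concatMap (insertions x) (perms xs)

-- XDes, positions (1-indexed, starting at i) listed increasingly
xdesFrom : Rel2 → ℕ → List ℕ → List ℕ
xdesFrom X i []           = []
xdesFrom X i (a ∷ [])     = []
xdesFrom X i (a ∷ b ∷ r)  =
  if X a b then i ∷ xdesFrom X (suc i) (b ∷ r) else xdesFrom X (suc i) (b ∷ r)

XDes : Rel2 → List ℕ → List ℕ
XDes X π = xdesFrom X 1 π

-- d_X(I;S): number of π ∈ 𝔖_S with XDes(π) = I  (I as increasing list)
dS : Rel2 → List ℕ → List ℕ → ℕ
dS X I S = length (filter (λ π → ≡-dec ℕ._≟_ (XDes X π) I) (perms S))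

d : Rel2 → List ℕ → ℕ → ℕ
d X I n = dS X I (range n)

-- standardization-invariance (finite S ⊆ ℕ as duplicate-free list)
StdInv : Rel2 → Set
StdInv X = (S : List ℕ) → Unique S → (I : List ℕ) → dS X I S ≡ d X I (length S)

sublists : List ℕ → List (List ℕ)
sublists []       = [] ∷ []
sublists (x ∷ xs) = map (x ∷_) (sublists xs) Data.List.++ sublists xs

-- for L = l₁ < … < l_r : C(n,l_r) C(l_r,l_{r-1}) ⋯ C(l₂,l₁); 1 if r = 0
binomChain : List ℕ → ℕ → ℕ
binomChain []           n = 1
binomChain (a ∷ [])     n = n C a
binomChain (a ∷ b ∷ r)  n = (b C a) * binomChain (b ∷ r) n

-- ∏_{t=0}^{r} d_X(∅; l_{t+1} - l_t) with l₀ = prev (start 0), l_{r+1} = n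
gapProd : Rel2 → ℕ → List ℕ → ℕ → ℕ
gapProd X prev []      n = d X [] (n ∸ prev)
gapProd X prev (a ∷ r) n = d X [] (a ∸ prev) * gapProd X a r n

rhs : Rel2 → List ℕ → ℕ → ℤ
rhs X I n = foldr ℤ._+_ (+ 0)
  (map (λ L → (-1ℤ ℤ.^ (length I ∸ length L)) ℤ.* (+ (binomChain L n * gapProd X 0 L n)))
       (sublists I))

module Submission where

-- Let i be the least element of I = i ∷ I' and write I' = shift i K. A permutation π of [N] has
-- XDes π ∈ {I, I'} exactly when its first i letters have no X-descent and the remaining N − i letters
-- have X-descent set K (the pair at the junction is then free). Choosing the set of the first i letters
-- and standardising both blocks gives
--   d(I; N) + d(I'; N) = C(N, i) · d(∅; i) · d(K; N − i).
-- Splitting the subsets of I according to whether they contain i shows that the alternating sum on the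
-- right-hand side satisfies the same recursion, and the theorem follows by induction on |I|.

open import Defs
import Algebra.Properties.CommutativeSemigroup as CommSemigroupProperties
open import Data.Bool.Base using (true; false; if_then_else_)
open import Data.Integer.Base as ℤ using (ℤ; +_; -1ℤ; -_)
import Data.Integer.Properties as ℤₚ
import Data.Integer.Tactic.RingSolver as ℤ-Solver
open import Data.List.Base using (List; []; _∷_; map; length; foldr; _++_; concatMap; take; drop; filter; upTo)
open import Data.List.Membership.Propositional using (_∈_)
open import Data.List.Properties
  using (map-∘; map-++; map-id; map-cong-local; map-injective; length-map; length-++; length-take; length-upTo;
         drop-all; take++drop≡id; ++-identityʳ; ∷-injectiveˡ; ∷-injectiveʳ; ≡-dec)
open import Data.List.Relation.Unary.All as All using (All; []; _∷_)
import Data.List.Relation.Unary.All.Properties as All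
open import Data.List.Relation.Unary.AllPairs as AllPairs using ([]; _∷_)
open import Data.List.Relation.Unary.Any using (here; there)
open import Data.List.Relation.Unary.Linked as Linked using (Linked; []; [-]; _∷_)
open import Data.List.Relation.Unary.Linked.Properties using (Linked⇒AllPairs)
open import Data.List.Relation.Unary.Unique.Propositional using (Unique)
import Data.List.Relation.Unary.Unique.Propositional.Properties as Unique
open import Data.Nat.Base using (ℕ; zero; suc; _+_; _*_; _∸_; _≤_; _<_; _!; z≤n; s≤s)
open import Data.Nat using (_≟_; _≤?_; _<?_)
open import Data.Nat.Combinatorics using (_C_; nCk≡n!/k![n-k]!; k![n∸k]!∣n!; k>n⇒nCk≡0; nCk+nC[k+1]≡[n+1]C[k+1])
open import Data.Nat.DivMod using (_/_; m/n*n≡m)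
open import Data.Nat.ListAction using (sum)
open import Data.Nat.ListAction.Properties using (sum-++)
open import Data.Nat.Properties
import Data.Nat.Tactic.RingSolver as ℕ-Solver
open import Data.Product using (_×_; _,_; proj₁; proj₂; ∃-syntax)
open import Data.Sum as Sum using (_⊎_; inj₁; inj₂)
open import Function.Base using (_∘_; id)
open import Function.Bundles using (mk⇔)
open import Level using (0ℓ)
open import Relation.Binary.PropositionalEquality
  using (_≡_; _≢_; refl; sym; trans; cong; cong₂; subst; module ≡-Reasoning)
open import Relation.Nullary using (Dec; does; yes; no)
open import Relation.Nullary.Decidable using (dec-false; does-⇔)
open import Relation.Unary using (Pred; Decidable)

open ≡-Reasoning
module ℕ+ = CommSemigroupProperties +-commutativeSemigroup
module ℕ* = CommSemigroupProperties *-commutativeSemigroup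
module ℤ* = CommSemigroupProperties ℤₚ.*-commutativeSemigroup

sumℕ : {A : Set} → (A → ℕ) → List A → ℕ
sumℕ f L = sum (map f L)

sumℕ-++ : {A : Set} (f : A → ℕ) (L M : List A) → sumℕ f (L ++ M) ≡ sumℕ f L + sumℕ f M
sumℕ-++ f L M = trans (cong sum (map-++ f L M)) (sum-++ (map f L) (map f M))

sumℕ-map : {A B : Set} (f : B → ℕ) (g : A → B) (L : List A) → sumℕ f (map g L) ≡ sumℕ (f ∘ g) L
sumℕ-map f g L = cong sum (sym (map-∘ L))

sumℕ-concatMap : {A B : Set} (f : B → ℕ) (h : A → List B) (L : List A) →
  sumℕ f (concatMap h L) ≡ sumℕ (sumℕ f ∘ h) L
sumℕ-concatMap f h []      = refl
sumℕ-concatMap f h (a ∷ L) =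
  trans (sumℕ-++ f (h a) (concatMap h L)) (cong (_+_ (sumℕ f (h a))) (sumℕ-concatMap f h L))

sumℕ-cong : {A : Set} {f g : A → ℕ} {L : List A} → All (λ a → f a ≡ g a) L → sumℕ f L ≡ sumℕ g L
sumℕ-cong f≡g = cong sum (map-cong-local f≡g)

sumℕ-+ : {A : Set} (f g : A → ℕ) (L : List A) → sumℕ (λ a → f a + g a) L ≡ sumℕ f L + sumℕ g L
sumℕ-+ f g []      = refl
sumℕ-+ f g (a ∷ L) = trans (cong (_+_ (f a + g a)) (sumℕ-+ f g L)) (ℕ+.interchange (f a) (g a) (sumℕ f L) (sumℕ g L))

sumℕ-*ˡ : {A : Set} (c : ℕ) (f : A → ℕ) (L : List A) → sumℕ (λ a → c * f a) L ≡ c * sumℕ f L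
sumℕ-*ˡ c f []      = sym (*-zeroʳ c)
sumℕ-*ˡ c f (a ∷ L) = trans (cong (_+_ (c * f a)) (sumℕ-*ˡ c f L)) (sym (*-distribˡ-+ c (f a) (sumℕ f L)))

sumℕ-*ʳ : {A : Set} (f : A → ℕ) (c : ℕ) (L : List A) → sumℕ (λ a → f a * c) L ≡ sumℕ f L * c
sumℕ-*ʳ f c []      = refl
sumℕ-*ʳ f c (a ∷ L) = trans (cong (_+_ (f a * c)) (sumℕ-*ʳ f c L)) (sym (*-distribʳ-+ c (f a) (sumℕ f L)))

sumℕ-const : {A : Set} (c : ℕ) (L : List A) → sumℕ (λ _ → c) L ≡ length L * c
sumℕ-const c []      = refl
sumℕ-const c (a ∷ L) = cong (_+_ c) (sumℕ-const c L)

sumℤ : {A : Set} → (A → ℤ) → List A → ℤ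
sumℤ f L = foldr ℤ._+_ (+ 0) (map f L)

sumℤ-++ : {A : Set} (f : A → ℤ) (L M : List A) → sumℤ f (L ++ M) ≡ sumℤ f L ℤ.+ sumℤ f M
sumℤ-++ f []      M = sym (ℤₚ.+-identityˡ (sumℤ f M))
sumℤ-++ f (a ∷ L) M = trans (cong (ℤ._+_ (f a)) (sumℤ-++ f L M)) (sym (ℤₚ.+-assoc (f a) (sumℤ f L) (sumℤ f M)))

sumℤ-map : {A B : Set} (f : B → ℤ) (g : A → B) (L : List A) → sumℤ f (map g L) ≡ sumℤ (f ∘ g) L
sumℤ-map f g L = cong (foldr ℤ._+_ (+ 0)) (sym (map-∘ L))

sumℤ-cong : {A : Set} {f g : A → ℤ} {L : List A} → All (λ a → f a ≡ g a) L → sumℤ f L ≡ sumℤ g L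
sumℤ-cong f≡g = cong (foldr ℤ._+_ (+ 0)) (map-cong-local f≡g)

sumℤ-*ˡ : {A : Set} (c : ℤ) (f : A → ℤ) (L : List A) → sumℤ (λ a → c ℤ.* f a) L ≡ c ℤ.* sumℤ f L
sumℤ-*ˡ c f []      = sym (ℤₚ.*-zeroʳ c)
sumℤ-*ˡ c f (a ∷ L) = trans (cong (ℤ._+_ (c ℤ.* f a)) (sumℤ-*ˡ c f L)) (sym (ℤₚ.*-distribˡ-+ c (f a) (sumℤ f L)))

sumℤ-neg : {A : Set} (f : A → ℤ) (L : List A) → sumℤ (λ a → - f a) L ≡ - sumℤ f L
sumℤ-neg f []      = refl
sumℤ-neg f (a ∷ L) = trans (cong (ℤ._+_ (- f a)) (sumℤ-neg f L)) (sym (ℤₚ.neg-distrib-+ (f a) (sumℤ f L)))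

take-++ : {A : Set} (α β : List A) (m : ℕ) → take (length α + m) (α ++ β) ≡ α ++ take m β
take-++ []      β m = refl
take-++ (a ∷ α) β m = cong (a ∷_) (take-++ α β m)

drop-++ : {A : Set} (α β : List A) (m : ℕ) → drop (length α + m) (α ++ β) ≡ drop m β
drop-++ []      β m = refl
drop-++ (a ∷ α) β m = drop-++ α β m

length-take-≤ : {A : Set} (k : ℕ) (σ : List A) → k ≤ length σ → length (take k σ) ≡ k
length-take-≤ k σ k≤ = trans (length-take k σ) (m≤n⇒m⊓n≡m k≤)

shift : ℕ → List ℕ → List ℕ
shift i = map (_+_ i)

shift-injective : ∀ i → (∀ {D E} → shift i D ≡ shift i E → D ≡ E)
shift-injective i = map-injective (+-cancelˡ-≡ i _ _)

range-unique : ∀ n → Unique (range n)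
range-unique n = Unique.map⁺ suc-injective (Unique.upTo⁺ n)

range-length : ∀ n → length (range n) ≡ n
range-length n = trans (length-map suc (upTo n)) (length-upTo n)

-- Permutations of a set, cut at a position

insertions-length : ∀ x σ → All (λ α → length α ≡ suc (length σ)) (insertions x σ)
insertions-length x []       = refl ∷ []
insertions-length x (y ∷ σ) = refl ∷ All.map⁺ (All.map (cong suc) (insertions-length x σ))

perms-length : ∀ S → All (λ π → length π ≡ length S) (perms S)
perms-length []      = refl ∷ []
perms-length (x ∷ S) = All.concat⁺ (All.map⁺ (All.map
  (λ {σ} |σ|≡ → All.map (λ |α|≡ → trans |α|≡ (cong suc |σ|≡)) (insertions-length x σ)) (perms-length S)))

laterInsertions : ℕ → List ℕ → List (List ℕ)
laterInsertions x []       = []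
laterInsertions x (y ∷ ys) = map (y ∷_) (insertions x ys)

insertions-take-drop : ∀ x k σ → insertions x σ ≡
  map (_++ drop k σ) (insertions x (take k σ)) ++ map (take k σ ++_) (laterInsertions x (drop k σ))
insertions-take-drop x zero    []       = refl
insertions-take-drop x zero    (y ∷ ys) = cong ((x ∷ y ∷ ys) ∷_) (sym (map-id (map (y ∷_) (insertions x ys))))
insertions-take-drop x (suc k) []       = refl
insertions-take-drop x (suc k) (y ∷ ys) = cong₂ _∷_ (cong (λ zs → x ∷ y ∷ zs) (sym (take++drop≡id k ys))) (begin
  map (y ∷_) (insertions x ys)
    ≡⟨ cong (map (y ∷_)) (insertions-take-drop x k ys) ⟩
  map (y ∷_) (map (_++ ys↓) (insertions x ys↑) ++ map (ys↑ ++_) (laterInsertions x ys↓))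
    ≡⟨ map-++ (y ∷_) (map (_++ ys↓) (insertions x ys↑)) (map (ys↑ ++_) (laterInsertions x ys↓)) ⟩
  map (y ∷_) (map (_++ ys↓) (insertions x ys↑)) ++ map (y ∷_) (map (ys↑ ++_) (laterInsertions x ys↓))
    ≡⟨ cong₂ _++_ (trans (sym (map-∘ (insertions x ys↑))) (map-∘ (insertions x ys↑)))
                  (sym (map-∘ (laterInsertions x ys↓))) ⟩
  map (_++ ys↓) (map (y ∷_) (insertions x ys↑)) ++ map ((y ∷ ys↑) ++_) (laterInsertions x ys↓) ∎)
  where
  ys↑ = take k ys
  ys↓ = drop k ys

splits : ℕ → List ℕ → List (List ℕ × List ℕ)
splits zero    S        = ([] , S) ∷ []
splits (suc k) []       = []
splits (suc k) (x ∷ xs) = map (λ (A , B) → x ∷ A , B) (splits k xs) ++ map (λ (A , B) → A , x ∷ B) (splits (suc k) xs)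

splits-length : ∀ k S → length (splits k S) ≡ length S C k
splits-length zero    S        = refl
splits-length (suc k) []       = refl
splits-length (suc k) (x ∷ xs) = begin
  length (map _ (splits k xs) ++ map _ (splits (suc k) xs))
    ≡⟨ length-++ (map _ (splits k xs)) ⟩
  length (map _ (splits k xs)) + length (map _ (splits (suc k) xs))
    ≡⟨ cong₂ _+_ (length-map _ (splits k xs)) (length-map _ (splits (suc k) xs)) ⟩
  length (splits k xs) + length (splits (suc k) xs)
    ≡⟨ cong₂ _+_ (splits-length k xs) (splits-length (suc k) xs) ⟩
  length xs C k + length xs C suc k
    ≡⟨ nCk+nC[k+1]≡[n+1]C[k+1] (length xs) k ⟩
  suc (length xs) C suc k ∎

splits-> : ∀ k S → length S < k → splits k S ≡ []
splits-> (suc k) []       _         = refl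
splits-> (suc k) (x ∷ xs) (s≤s |xs|<k)
  rewrite splits-> k xs |xs|<k | splits-> (suc k) xs (m<n⇒m<1+n |xs|<k) = refl

record IsSplit (k : ℕ) (S A B : List ℕ) : Set where
  field
    length-A   : length A ≡ k
    length-A+B : length A + length B ≡ length S
    unique-A   : Unique A
    unique-B   : Unique B
    A⊆S        : All (_∈ S) A
    B⊆S        : All (_∈ S) B

splits-IsSplit : ∀ k S → Unique S → All (λ (A , B) → IsSplit k S A B) (splits k S)
splits-IsSplit zero    S        unique-S = record
  { length-A = refl ; length-A+B = refl ; unique-A = [] ; unique-B = unique-S ; A⊆S = [] ; B⊆S = All.tabulate id } ∷ []
splits-IsSplit (suc k) []       _               = []
splits-IsSplit (suc k) (x ∷ xs) (x∉xs ∷ unique-xs) =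
  All.++⁺ (All.map⁺ (All.map withX (splits-IsSplit k xs unique-xs)))
          (All.map⁺ (All.map withoutX (splits-IsSplit (suc k) xs unique-xs)))
  where
  x∉ : ∀ {C} → All (_∈ xs) C → All (x ≢_) C
  x∉ = All.map (All.lookup x∉xs)
  withX : ∀ {A B} → IsSplit k xs A B → IsSplit (suc k) (x ∷ xs) (x ∷ A) B
  withX s = record
    { length-A = cong suc length-A ; length-A+B = cong suc length-A+B
    ; unique-A = x∉ A⊆S ∷ unique-A ; unique-B = unique-B
    ; A⊆S = here refl ∷ All.map there A⊆S ; B⊆S = All.map there B⊆S }
    where open IsSplit s
  withoutX : ∀ {A B} → IsSplit (suc k) xs A B → IsSplit (suc k) (x ∷ xs) A (x ∷ B)
  withoutX {A} {B} s = record
    { length-A = length-A ; length-A+B = trans (+-suc (length A) (length B)) (cong suc length-A+B)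
    ; unique-A = unique-A ; unique-B = x∉ B⊆S ∷ unique-B
    ; A⊆S = All.map there A⊆S ; B⊆S = here refl ∷ All.map there B⊆S }
    where open IsSplit s

_⟨_⟩_ : (List ℕ → ℕ) → ℕ → (List ℕ → ℕ) → List ℕ → ℕ
(f ⟨ k ⟩ g) π = f (take k π) * g (drop k π)

sumℕ-insertions-⟨suc⟩ : ∀ x k (f g : List ℕ → ℕ) σ → k ≤ length σ →
  sumℕ (f ⟨ suc k ⟩ g) (insertions x σ) ≡
  ((sumℕ f ∘ insertions x) ⟨ k ⟩ g) σ + sumℕ (f ⟨ suc k ⟩ g) (map (take k σ ++_) (laterInsertions x (drop k σ)))
sumℕ-insertions-⟨suc⟩ x k f g σ k≤|σ| = begin
  sumℕ F (insertions x σ)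
    ≡⟨ cong (sumℕ F) (insertions-take-drop x k σ) ⟩
  sumℕ F (map (_++ σ↓) (insertions x σ↑) ++ later)
    ≡⟨ sumℕ-++ F (map (_++ σ↓) (insertions x σ↑)) later ⟩
  sumℕ F (map (_++ σ↓) (insertions x σ↑)) + sumℕ F later
    ≡⟨ cong (_+ sumℕ F later) (sumℕ-map F (_++ σ↓) (insertions x σ↑)) ⟩
  sumℕ (F ∘ (_++ σ↓)) (insertions x σ↑) + sumℕ F later
    ≡⟨ cong (_+ sumℕ F later) (sumℕ-cong (All.map F[α++σ↓] (insertions-length x σ↑))) ⟩
  sumℕ (λ α → f α * g σ↓) (insertions x σ↑) + sumℕ F later
    ≡⟨ cong (_+ sumℕ F later) (sumℕ-*ʳ f (g σ↓) (insertions x σ↑)) ⟩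
  sumℕ f (insertions x σ↑) * g σ↓ + sumℕ F later ∎
  where
  F = f ⟨ suc k ⟩ g
  σ↑ = take k σ
  σ↓ = drop k σ
  later = map (σ↑ ++_) (laterInsertions x σ↓)
  F[α++σ↓] : ∀ {α} → length α ≡ suc (length σ↑) → F (α ++ σ↓) ≡ f α * g σ↓
  F[α++σ↓] {α} |α|≡ = cong₂ (λ p q → f p * g q)
    (trans (cong (λ j → take j (α ++ σ↓)) 1+k≡) (trans (take-++ α σ↓ 0) (++-identityʳ α)))
    (trans (cong (λ j → drop j (α ++ σ↓)) 1+k≡) (drop-++ α σ↓ 0))
    where
    1+k≡ : suc k ≡ length α + 0
    1+k≡ = sym (trans (+-identityʳ (length α)) (trans |α|≡ (cong suc (length-take-≤ k σ k≤|σ|))))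

sumℕ-laterInsertions : ∀ x k (f g : List ℕ → ℕ) σ → k < length σ →
  sumℕ (f ⟨ suc k ⟩ g) (map (take k σ ++_) (laterInsertions x (drop k σ))) ≡
  (f ⟨ suc k ⟩ (sumℕ g ∘ insertions x)) σ
sumℕ-laterInsertions x zero    f g (y ∷ ys) _ = begin
  sumℕ F (map ([] ++_) (map (y ∷_) (insertions x ys)))  ≡⟨ cong (sumℕ F) (map-id (map (y ∷_) (insertions x ys))) ⟩
  sumℕ F (map (y ∷_) (insertions x ys))                 ≡⟨ sumℕ-map F (y ∷_) (insertions x ys) ⟩
  sumℕ (λ γ → f (y ∷ []) * g γ) (insertions x ys)       ≡⟨ sumℕ-*ˡ (f (y ∷ [])) g (insertions x ys) ⟩
  f (y ∷ []) * sumℕ g (insertions x ys)                 ∎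
  where F = f ⟨ 1 ⟩ g
sumℕ-laterInsertions x (suc k) f g (z ∷ σ) (s≤s k<|σ|) = begin
  sumℕ (f ⟨ suc (suc k) ⟩ g) (map ((z ∷ take k σ) ++_) later)
    ≡⟨ cong (sumℕ (f ⟨ suc (suc k) ⟩ g)) (map-∘ later) ⟩
  sumℕ (f ⟨ suc (suc k) ⟩ g) (map (z ∷_) (map (take k σ ++_) later))
    ≡⟨ sumℕ-map (f ⟨ suc (suc k) ⟩ g) (z ∷_) (map (take k σ ++_) later) ⟩
  sumℕ ((f ∘ (z ∷_)) ⟨ suc k ⟩ g) (map (take k σ ++_) later)
    ≡⟨ sumℕ-laterInsertions x k (f ∘ (z ∷_)) g σ k<|σ| ⟩
  f (z ∷ take (suc k) σ) * sumℕ g (insertions x (drop (suc k) σ)) ∎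
  where later = laterInsertions x (drop k σ)

splitSum : (List ℕ → ℕ) → (List ℕ → ℕ) → List ℕ × List ℕ → ℕ
splitSum f g (A , B) = sumℕ f (perms A) * sumℕ g (perms B)

sumℕ-perms-∷ : ∀ (f : List ℕ → ℕ) x A → sumℕ f (perms (x ∷ A)) ≡ sumℕ (sumℕ f ∘ insertions x) (perms A)
sumℕ-perms-∷ f x A = sumℕ-concatMap f (insertions x) (perms A)

sumℕ-splitSum-splits-suc : ∀ (f g : List ℕ → ℕ) k x xs → sumℕ (splitSum f g) (splits (suc k) (x ∷ xs)) ≡
  sumℕ (splitSum (sumℕ f ∘ insertions x) g) (splits k xs) + sumℕ (splitSum f (sumℕ g ∘ insertions x)) (splits (suc k) xs)
sumℕ-splitSum-splits-suc f g k x xs = begin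
  sumℕ (splitSum f g) (map _ (splits k xs) ++ map _ (splits (suc k) xs))
    ≡⟨ sumℕ-++ (splitSum f g) (map _ (splits k xs)) (map _ (splits (suc k) xs)) ⟩
  sumℕ (splitSum f g) (map _ (splits k xs)) + sumℕ (splitSum f g) (map _ (splits (suc k) xs))
    ≡⟨ cong₂ _+_ (sumℕ-map (splitSum f g) _ (splits k xs)) (sumℕ-map (splitSum f g) _ (splits (suc k) xs)) ⟩
  sumℕ (λ (A , B) → splitSum f g (x ∷ A , B)) (splits k xs) +
  sumℕ (λ (A , B) → splitSum f g (A , x ∷ B)) (splits (suc k) xs)
    ≡⟨ cong₂ _+_
         (sumℕ-cong (All.universal (λ (A , B) → cong (_* sumℕ g (perms B)) (sumℕ-perms-∷ f x A)) (splits k xs)))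
         (sumℕ-cong (All.universal (λ (A , B) → cong (sumℕ f (perms A) *_) (sumℕ-perms-∷ g x B)) (splits (suc k) xs))) ⟩
  sumℕ (splitSum (sumℕ f ∘ insertions x) g) (splits k xs) +
  sumℕ (splitSum f (sumℕ g ∘ insertions x)) (splits (suc k) xs) ∎

sumℕ-perms-∷-⟨suc⟩ : ∀ x xs k (f g : List ℕ → ℕ) → k ≤ length xs →
  sumℕ (f ⟨ suc k ⟩ g) (perms (x ∷ xs)) ≡
  sumℕ ((sumℕ f ∘ insertions x) ⟨ k ⟩ g) (perms xs) +
  sumℕ (λ σ → sumℕ (f ⟨ suc k ⟩ g) (map (take k σ ++_) (laterInsertions x (drop k σ)))) (perms xs)
sumℕ-perms-∷-⟨suc⟩ x xs k f g k≤|xs| = begin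
  sumℕ (f ⟨ suc k ⟩ g) (perms (x ∷ xs))
    ≡⟨ sumℕ-perms-∷ (f ⟨ suc k ⟩ g) x xs ⟩
  sumℕ (sumℕ (f ⟨ suc k ⟩ g) ∘ insertions x) (perms xs)
    ≡⟨ sumℕ-cong (All.map (λ {σ} |σ|≡ → sumℕ-insertions-⟨suc⟩ x k f g σ (subst (k ≤_) (sym |σ|≡) k≤|xs|))
                          (perms-length xs)) ⟩
  sumℕ (λ σ → ((sumℕ f ∘ insertions x) ⟨ k ⟩ g) σ + later σ) (perms xs)
    ≡⟨ sumℕ-+ ((sumℕ f ∘ insertions x) ⟨ k ⟩ g) later (perms xs) ⟩
  sumℕ ((sumℕ f ∘ insertions x) ⟨ k ⟩ g) (perms xs) + sumℕ later (perms xs) ∎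
  where
  later : List ℕ → ℕ
  later σ = sumℕ (f ⟨ suc k ⟩ g) (map (take k σ ++_) (laterInsertions x (drop k σ)))

-- f and g must stay arbitrary: the induction step replaces them by their sums over the insertions of x.
sumℕ-perms-⟨⟩ : ∀ S k → k ≤ length S → ∀ (f g : List ℕ → ℕ) →
  sumℕ (f ⟨ k ⟩ g) (perms S) ≡ sumℕ (splitSum f g) (splits k S)
sumℕ-perms-⟨⟩ S zero _ f g = begin
  sumℕ (λ π → f [] * g π) (perms S)   ≡⟨ sumℕ-*ˡ (f []) g (perms S) ⟩
  f [] * sumℕ g (perms S)             ≡⟨ cong (_* sumℕ g (perms S)) (sym (+-identityʳ (f []))) ⟩
  (f [] + 0) * sumℕ g (perms S)       ≡⟨ sym (+-identityʳ _) ⟩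
  (f [] + 0) * sumℕ g (perms S) + 0   ∎
sumℕ-perms-⟨⟩ (x ∷ xs) (suc k) (s≤s k≤|xs|) f g = begin
  sumℕ (f ⟨ suc k ⟩ g) (perms (x ∷ xs))
    ≡⟨ sumℕ-perms-∷-⟨suc⟩ x xs k f g k≤|xs| ⟩
  sumℕ (f' ⟨ k ⟩ g) (perms xs) + sumℕ later (perms xs)
    ≡⟨ cong₂ _+_ (sumℕ-perms-⟨⟩ xs k k≤|xs| f' g) laterSum ⟩
  sumℕ (splitSum f' g) (splits k xs) + sumℕ (splitSum f g') (splits (suc k) xs)
    ≡⟨ sym (sumℕ-splitSum-splits-suc f g k x xs) ⟩
  sumℕ (splitSum f g) (splits (suc k) (x ∷ xs)) ∎
  where
  f' g' later : List ℕ → ℕ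
  f' = sumℕ f ∘ insertions x
  g' = sumℕ g ∘ insertions x
  later σ = sumℕ (f ⟨ suc k ⟩ g) (map (take k σ ++_) (laterInsertions x (drop k σ)))
  laterSum : sumℕ later (perms xs) ≡ sumℕ (splitSum f g') (splits (suc k) xs)
  laterSum with k <? length xs
  ... | yes k<|xs| = trans
    (sumℕ-cong (All.map (λ {σ} |σ|≡ → sumℕ-laterInsertions x k f g σ (subst (k <_) (sym |σ|≡) k<|xs|))
                        (perms-length xs)))
    (sumℕ-perms-⟨⟩ xs (suc k) k<|xs| f g')
  ... | no k≮|xs| = begin
    sumℕ later (perms xs)
      ≡⟨ sumℕ-cong (All.map (λ {σ} |σ|≡ → cong (λ σ↓ → sumℕ (f ⟨ suc k ⟩ g) (map (take k σ ++_) (laterInsertions x σ↓)))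
                                                 (drop-all k σ (subst (_≤ k) (sym |σ|≡) (≮⇒≥ k≮|xs|))))
                            (perms-length xs)) ⟩
    sumℕ (λ _ → 0) (perms xs)
      ≡⟨ trans (sumℕ-const 0 (perms xs)) (*-zeroʳ (length (perms xs))) ⟩
    0
      ≡⟨ cong (sumℕ (splitSum f g')) (sym (splits-> (suc k) xs (s≤s (≮⇒≥ k≮|xs|)))) ⟩
    sumℕ (splitSum f g') (splits (suc k) xs) ∎

-- Descent sets of a concatenation

xdesFrom-++ : ∀ X j a α b γ → ∃[ B ] (B ≡ [] ⊎ B ≡ length α + j ∷ []) ×
  xdesFrom X j (a ∷ α ++ b ∷ γ) ≡ xdesFrom X j (a ∷ α) ++ B ++ xdesFrom X (suc (length α + j)) (b ∷ γ)
xdesFrom-++ X j a []      b γ with X a b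
... | true  = j ∷ [] , inj₂ refl , refl
... | false = []     , inj₁ refl , refl
xdesFrom-++ X j a (c ∷ α) b γ rewrite sym (+-suc (length α) j) with xdesFrom-++ X (suc j) c α b γ | X a c
... | B , B≡ , eq | true  = B , B≡ , cong (j ∷_) eq
... | B , B≡ , eq | false = B , B≡ , eq

xdesFrom-≥ : ∀ X j L → All (j ≤_) (xdesFrom X j L)
xdesFrom-≥ X j []          = []
xdesFrom-≥ X j (a ∷ [])    = []
xdesFrom-≥ X j (a ∷ b ∷ L) with X a b | xdesFrom-≥ X (suc j) (b ∷ L)
... | true  | ih = ≤-refl ∷ All.map (≤-trans (n≤1+n j)) ih
... | false | ih = All.map (≤-trans (n≤1+n j)) ih

xdesFrom-< : ∀ X j a α → All (_< length α + j) (xdesFrom X j (a ∷ α))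
xdesFrom-< X j a []      = []
xdesFrom-< X j a (c ∷ α) rewrite sym (+-suc (length α) j) with X a c
... | true  = m≤n+m (suc j) (length α) ∷ xdesFrom-< X (suc j) c α
... | false = xdesFrom-< X (suc j) c α

xdesFrom-shift : ∀ X m j L → xdesFrom X (m + j) L ≡ shift m (xdesFrom X j L)
xdesFrom-shift X m j []          = refl
xdesFrom-shift X m j (a ∷ [])    = refl
xdesFrom-shift X m j (a ∷ b ∷ L) with X a b | xdesFrom-shift X m (suc j) (b ∷ L)
... | true  | ih = cong (m + j ∷_) (trans (cong (λ k → xdesFrom X k (b ∷ L)) (sym (+-suc m j))) ih)
... | false | ih = trans (cong (λ k → xdesFrom X k (b ∷ L)) (sym (+-suc m j))) ih

XDes-++ : ∀ X a α b γ → ∃[ B ] (B ≡ [] ⊎ B ≡ suc (length α) ∷ []) ×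
  XDes X (a ∷ α ++ b ∷ γ) ≡ XDes X (a ∷ α) ++ B ++ shift (suc (length α)) (XDes X (b ∷ γ))
XDes-++ X a α b γ with xdesFrom-++ X 1 a α b γ
... | B , B≡ , eq = B , Sum.map₂ (λ B≡[p] → trans B≡[p] (cong (_∷ []) (+-comm (length α) 1))) B≡
                      , trans eq (cong (λ D → XDes X (a ∷ α) ++ B ++ D) (xdesFrom-shift X (suc (length α)) 1 (b ∷ γ)))

XDes-< : ∀ X a α → All (_< suc (length α)) (XDes X (a ∷ α))
XDes-< X a α = subst (λ p → All (_< p) (XDes X (a ∷ α))) (+-comm (length α) 1) (xdesFrom-< X 1 a α)

χ : {P : Set} → Dec P → ℕ
χ p = if does p then 1 else 0

length-filter≡sumℕ-χ : {A : Set} {P : Pred A 0ℓ} (P? : Decidable P) (L : List A) →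
  length (filter P? L) ≡ sumℕ (χ ∘ P?) L
length-filter≡sumℕ-χ P? []      = refl
length-filter≡sumℕ-χ P? (x ∷ L) with does (P? x)
... | true  = cong suc (length-filter≡sumℕ-χ P? L)
... | false = length-filter≡sumℕ-χ P? L

χ≡ : List ℕ → List ℕ → ℕ
χ≡ D E = χ (≡-dec _≟_ D E)

χ≡-≢ : ∀ {D E} → D ≢ E → χ≡ D E ≡ 0
χ≡-≢ {D} {E} D≢E = cong (if_then 1 else 0) (dec-false (≡-dec _≟_ D E) D≢E)

χ≡-injective : ∀ (f : List ℕ → List ℕ) → (∀ {D E} → f D ≡ f E → D ≡ E) →
  ∀ D E → χ≡ (f D) (f E) ≡ χ≡ D E
χ≡-injective f f-inj D E =
  cong (if_then 1 else 0) (does-⇔ (mk⇔ f-inj (cong f)) (≡-dec _≟_ (f D) (f E)) (≡-dec _≟_ D E))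

∷≢shift : ∀ {a i R K} → a ≤ i → All (1 ≤_) K → a ∷ R ≢ shift i K
∷≢shift a≤i (1≤k ∷ _) eq = <⇒≢ (≤-<-trans a≤i (m<m+n _ 1≤k)) (∷-injectiveˡ eq)

-- Applied with XDes π = A ++ B ++ shift i E, where A, B and E are the X-descents before, at and after
-- the junction of the first i letters of π with the rest.
χ≡-glue : ∀ i A B E K → All (_< i) A → B ≡ [] ⊎ B ≡ i ∷ [] → All (1 ≤_) E → All (1 ≤_) K →
  χ≡ (A ++ B ++ shift i E) (i ∷ shift i K) + χ≡ (A ++ B ++ shift i E) (shift i K) ≡ χ≡ A [] * χ≡ E K
χ≡-glue i (a ∷ A) B E K (a<i ∷ _) _ _ 1≤K =
  cong₂ _+_ (χ≡-≢ {D} (λ eq → <⇒≢ a<i (∷-injectiveˡ eq))) (χ≡-≢ {D} (∷≢shift (<⇒≤ a<i) 1≤K))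
  where D = a ∷ A ++ B ++ shift i E
χ≡-glue i [] B E K _ (inj₁ refl) 1≤E _ = begin
  χ≡ (shift i E) (i ∷ shift i K) + χ≡ (shift i E) (shift i K)
    ≡⟨ cong₂ _+_ (χ≡-≢ (∷≢shift ≤-refl 1≤E ∘ sym)) (χ≡-injective (shift i) (shift-injective i) E K) ⟩
  χ≡ E K      ≡⟨ sym (+-identityʳ (χ≡ E K)) ⟩
  1 * χ≡ E K  ∎
χ≡-glue i [] B E K _ (inj₂ refl) _ 1≤K =
  cong₂ _+_ (χ≡-injective ((i ∷_) ∘ shift i) (shift-injective i ∘ ∷-injectiveʳ) E K)
            (χ≡-≢ (∷≢shift ≤-refl 1≤K))

hasXDes : Rel2 → List ℕ → List ℕ → ℕ
hasXDes X I π = χ≡ (XDes X π) I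

dS≡sumℕ-hasXDes : ∀ X I S → dS X I S ≡ sumℕ (hasXDes X I) (perms S)
dS≡sumℕ-hasXDes X I S = length-filter≡sumℕ-χ (λ π → ≡-dec _≟_ (XDes X π) I) (perms S)

take-drop-∷ : {A : Set} (i' : ℕ) (π : List A) → suc i' < length π →
  ∃[ a ] ∃[ α ] ∃[ b ] ∃[ γ ] take (suc i') π ≡ a ∷ α × length α ≡ i' × drop (suc i') π ≡ b ∷ γ
take-drop-∷ zero     (a ∷ b ∷ γ) _           = a , [] , b , γ , refl , refl , refl
take-drop-∷ zero     (a ∷ [])    (s≤s ())
take-drop-∷ (suc i') (a ∷ π)     (s≤s i<|π|) with take-drop-∷ i' π i<|π|
... | a' , α , b , γ , π↑≡ , refl , π↓≡ = a , a' ∷ α , b , γ , cong (a ∷_) π↑≡ , refl , π↓≡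

hasXDes-cons-shift : ∀ X i' K π → suc i' < length π → All (1 ≤_) K →
  hasXDes X (suc i' ∷ shift (suc i') K) π + hasXDes X (shift (suc i') K) π ≡ (hasXDes X [] ⟨ suc i' ⟩ hasXDes X K) π
hasXDes-cons-shift X i' K π i<|π| 1≤K with take-drop-∷ i' π i<|π|
... | a , α , b , γ , π↑≡ , refl , π↓≡ with XDes-++ X a α b γ
... | B , B≡ , XDes≡ = begin
  χ≡ (XDes X π) (i ∷ shift i K) + χ≡ (XDes X π) (shift i K)
    ≡⟨ cong (λ D → χ≡ D (i ∷ shift i K) + χ≡ D (shift i K)) (trans (cong (XDes X) π≡) XDes≡) ⟩
  χ≡ (A ++ B ++ shift i E) (i ∷ shift i K) + χ≡ (A ++ B ++ shift i E) (shift i K)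
    ≡⟨ χ≡-glue i A B E K (XDes-< X a α) B≡ (xdesFrom-≥ X 1 (b ∷ γ)) 1≤K ⟩
  χ≡ A [] * χ≡ E K
    ≡⟨ sym (cong₂ (λ π↑ π↓ → hasXDes X [] π↑ * hasXDes X K π↓) π↑≡ π↓≡) ⟩
  (hasXDes X [] ⟨ i ⟩ hasXDes X K) π ∎
  where
  i = suc (length α)
  A = XDes X (a ∷ α)
  E = XDes X (b ∷ γ)
  π≡ : π ≡ a ∷ α ++ b ∷ γ
  π≡ = trans (sym (take++drop≡id i π)) (cong₂ _++_ π↑≡ π↓≡)

-- The recursion for d

d-cons-shift : ∀ X → StdInv X → ∀ i' n K → All (1 ≤_) K →
  d X (suc i' ∷ shift (suc i') K) (suc i' + suc n) + d X (shift (suc i') K) (suc i' + suc n)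
    ≡ ((suc i' + suc n) C suc i') * (d X [] (suc i') * d X K (suc n))
d-cons-shift X std i' n K 1≤K = begin
  d X I N + d X J N
    ≡⟨ cong₂ _+_ (dS≡sumℕ-hasXDes X I S) (dS≡sumℕ-hasXDes X J S) ⟩
  sumℕ (hasXDes X I) (perms S) + sumℕ (hasXDes X J) (perms S)
    ≡⟨ sym (sumℕ-+ (hasXDes X I) (hasXDes X J) (perms S)) ⟩
  sumℕ (λ π → hasXDes X I π + hasXDes X J π) (perms S)
    ≡⟨ sumℕ-cong (All.map (λ {π} |π|≡ → hasXDes-cons-shift X i' K π (subst (i <_) (sym (trans |π|≡ |S|≡N)) i<N) 1≤K)
                          (perms-length S)) ⟩
  sumℕ (hasXDes X [] ⟨ i ⟩ hasXDes X K) (perms S)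
    ≡⟨ sumℕ-perms-⟨⟩ S i (subst (i ≤_) (sym |S|≡N) (<⇒≤ i<N)) (hasXDes X []) (hasXDes X K) ⟩
  sumℕ (splitSum (hasXDes X []) (hasXDes X K)) (splits i S)
    ≡⟨ sumℕ-cong (All.map splitSum≡ (splits-IsSplit i S (range-unique N))) ⟩
  sumℕ (λ _ → c) (splits i S)
    ≡⟨ sumℕ-const c (splits i S) ⟩
  length (splits i S) * c
    ≡⟨ cong (_* c) (trans (splits-length i S) (cong (_C i) |S|≡N)) ⟩
  (N C i) * c ∎
  where
  i = suc i'
  N = i + suc n
  I = i ∷ shift i K
  J = shift i K
  S = range N
  c = d X [] i * d X K (suc n)
  |S|≡N : length S ≡ N
  |S|≡N = range-length N
  i<N : i < N
  i<N = m<m+n i (s≤s z≤n)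
  splitSum≡ : ∀ {AB} → IsSplit i S (proj₁ AB) (proj₂ AB) → splitSum (hasXDes X []) (hasXDes X K) AB ≡ c
  splitSum≡ {A , B} s = cong₂ _*_
    (trans (sym (dS≡sumℕ-hasXDes X [] A)) (trans (std A unique-A []) (cong (d X []) length-A)))
    (trans (sym (dS≡sumℕ-hasXDes X K B)) (trans (std B unique-B K) (cong (d X K) |B|≡)))
    where
    open IsSplit s
    |B|≡ : length B ≡ suc n
    |B|≡ = +-cancelˡ-≡ i (length B) (suc n) (trans (cong (_+ length B) (sym length-A)) (trans length-A+B |S|≡N))

x≡[x+y]-y : ∀ x y → x ≡ (x ℤ.+ y) ℤ.- y
x≡[x+y]-y = ℤ-Solver.solve-∀

+d-cons-shift : ∀ X → StdInv X → ∀ i' n K → All (1 ≤_) K →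
  + d X (suc i' ∷ shift (suc i') K) (suc i' + suc n)
    ≡ + (((suc i' + suc n) C suc i') * d X [] (suc i')) ℤ.* + d X K (suc n) ℤ.- + d X (shift (suc i') K) (suc i' + suc n)
+d-cons-shift X std i' n K 1≤K = begin
  + d X I N                                    ≡⟨ x≡[x+y]-y (+ d X I N) (+ d X J N) ⟩
  + d X I N ℤ.+ + d X J N ℤ.- + d X J N        ≡⟨ cong (ℤ._- + d X J N) (sym (ℤₚ.pos-+ (d X I N) (d X J N))) ⟩
  + (d X I N + d X J N) ℤ.- + d X J N          ≡⟨ cong (λ x → + x ℤ.- + d X J N) (d-cons-shift X std i' n K 1≤K) ⟩
  + ((N C i) * (dA * dK)) ℤ.- + d X J N        ≡⟨ cong (λ x → + x ℤ.- + d X J N) (sym (*-assoc (N C i) dA dK)) ⟩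
  + ((N C i) * dA * dK) ℤ.- + d X J N          ≡⟨ cong (ℤ._- + d X J N) (ℤₚ.pos-* ((N C i) * dA) dK) ⟩
  + ((N C i) * dA) ℤ.* + dK ℤ.- + d X J N      ∎
  where
  i = suc i'
  N = i + suc n
  I = i ∷ shift i K
  J = shift i K
  dA = d X [] i
  dK = d X K (suc n)

nCk*k![n∸k]!≡n! : ∀ {n k} → k ≤ n → (n C k) * (k ! * (n ∸ k) !) ≡ n !
nCk*k![n∸k]!≡n! {n} {k} k≤n = begin
  (n C k) * (k ! * (n ∸ k) !)                  ≡⟨ cong (_* (k ! * (n ∸ k) !)) (nCk≡n!/k![n-k]! k≤n) ⟩
  (n ! / (k ! * (n ∸ k) !)) * (k ! * (n ∸ k) !) ≡⟨ m/n*n≡m (k![n∸k]!∣n! k≤n) ⟩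
  n !                                          ∎
  where instance _ = k !* (n ∸ k) !≢0

[k+m]Ck*k!*m!≡[k+m]! : ∀ k m → ((k + m) C k) * (k ! * m !) ≡ (k + m) !
[k+m]Ck*k!*m!≡[k+m]! k m = begin
  ((k + m) C k) * (k ! * m !)             ≡⟨ cong (λ j → ((k + m) C k) * (k ! * j !)) (sym (m+n∸m≡n k m)) ⟩
  ((k + m) C k) * (k ! * (k + m ∸ k) !)   ≡⟨ nCk*k![n∸k]!≡n! (m≤m+n k m) ⟩
  (k + m) !                               ∎

[k+[l+m]]C[k+l]*[k+l]Ck≡[k+[l+m]]Ck*[l+m]Cl : ∀ k l m →
  ((k + (l + m)) C (k + l)) * ((k + l) C k) ≡ ((k + (l + m)) C k) * ((l + m) C l)
[k+[l+m]]C[k+l]*[k+l]Ck≡[k+[l+m]]Ck*[l+m]Cl k l m =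
  *-cancelʳ-≡ _ _ (k ! * (l ! * m !)) (trans lhs≡ (sym rhs≡))
  where
  instance _ = m*n≢0 (k !) (l ! * m !) {{k !≢0}} {{l !* m !≢0}}
  reassocˡ : ∀ a b x y z → a * b * (x * (y * z)) ≡ a * ((b * (x * y)) * z)
  reassocˡ = ℕ-Solver.solve-∀
  reassocʳ : ∀ a b x y z → a * b * (x * (y * z)) ≡ a * (x * (b * (y * z)))
  reassocʳ = ℕ-Solver.solve-∀
  lhs≡ : ((k + (l + m)) C (k + l)) * ((k + l) C k) * (k ! * (l ! * m !)) ≡ (k + (l + m)) !
  lhs≡ = begin
    ((k + (l + m)) C (k + l)) * ((k + l) C k) * (k ! * (l ! * m !))
      ≡⟨ reassocˡ ((k + (l + m)) C (k + l)) ((k + l) C k) (k !) (l !) (m !) ⟩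
    ((k + (l + m)) C (k + l)) * ((((k + l) C k) * (k ! * l !)) * m !)
      ≡⟨ cong (λ x → ((k + (l + m)) C (k + l)) * (x * m !)) ([k+m]Ck*k!*m!≡[k+m]! k l) ⟩
    ((k + (l + m)) C (k + l)) * ((k + l) ! * m !)
      ≡⟨ cong (λ j → (j C (k + l)) * ((k + l) ! * m !)) (sym (+-assoc k l m)) ⟩
    ((k + l + m) C (k + l)) * ((k + l) ! * m !)
      ≡⟨ [k+m]Ck*k!*m!≡[k+m]! (k + l) m ⟩
    (k + l + m) !
      ≡⟨ cong _! (+-assoc k l m) ⟩
    (k + (l + m)) ! ∎
  rhs≡ : ((k + (l + m)) C k) * ((l + m) C l) * (k ! * (l ! * m !)) ≡ (k + (l + m)) !
  rhs≡ = begin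
    ((k + (l + m)) C k) * ((l + m) C l) * (k ! * (l ! * m !))
      ≡⟨ reassocʳ ((k + (l + m)) C k) ((l + m) C l) (k !) (l !) (m !) ⟩
    ((k + (l + m)) C k) * (k ! * (((l + m) C l) * (l ! * m !)))
      ≡⟨ cong (λ x → ((k + (l + m)) C k) * (k ! * x)) ([k+m]Ck*k!*m!≡[k+m]! l m) ⟩
    ((k + (l + m)) C k) * (k ! * (l + m) !)
      ≡⟨ [k+m]Ck*k!*m!≡[k+m]! k (l + m) ⟩
    (k + (l + m)) ! ∎

[i+b]C[i+a]*[i+a]Ci≡[i+b]Ci*bCa : ∀ i a b → ((i + b) C (i + a)) * ((i + a) C i) ≡ ((i + b) C i) * (b C a)
[i+b]C[i+a]*[i+a]Ci≡[i+b]Ci*bCa i a b with a ≤? b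
... | yes a≤b with m≤n⇒∃[o]m+o≡n a≤b
...   | c , refl = [k+[l+m]]C[k+l]*[k+l]Ck≡[k+[l+m]]Ck*[l+m]Cl i a c
[i+b]C[i+a]*[i+a]Ci≡[i+b]Ci*bCa i a b | no a≰b = begin
  ((i + b) C (i + a)) * ((i + a) C i) ≡⟨ cong (_* ((i + a) C i)) (k>n⇒nCk≡0 (+-monoʳ-< i b<a)) ⟩
  0                                   ≡⟨ sym (*-zeroʳ ((i + b) C i)) ⟩
  ((i + b) C i) * 0                   ≡⟨ cong (((i + b) C i) *_) (sym (k>n⇒nCk≡0 b<a)) ⟩
  ((i + b) C i) * (b C a)             ∎
  where b<a = ≰⇒> a≰b

-- The recursion for the right-hand side

binomChain-shift : ∀ i a r n →
  ((i + a) C i) * binomChain (shift i (a ∷ r)) (i + n) ≡ ((i + n) C i) * binomChain (a ∷ r) n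
binomChain-shift i a []      n = trans (*-comm ((i + a) C i) ((i + n) C (i + a))) ([i+b]C[i+a]*[i+a]Ci≡[i+b]Ci*bCa i a n)
binomChain-shift i a (b ∷ r) n = begin
  ((i + a) C i) * (((i + b) C (i + a)) * chain)   ≡⟨ ℕ*.x∙yz≈yx∙z ((i + a) C i) ((i + b) C (i + a)) chain ⟩
  (((i + b) C (i + a)) * ((i + a) C i)) * chain   ≡⟨ cong (_* chain) ([i+b]C[i+a]*[i+a]Ci≡[i+b]Ci*bCa i a b) ⟩
  (((i + b) C i) * (b C a)) * chain               ≡⟨ ℕ*.xy∙z≈y∙xz ((i + b) C i) (b C a) chain ⟩
  (b C a) * (((i + b) C i) * chain)               ≡⟨ cong ((b C a) *_) (binomChain-shift i b r n) ⟩
  (b C a) * (((i + n) C i) * binomChain (b ∷ r) n) ≡⟨ ℕ*.x∙yz≈y∙xz (b C a) ((i + n) C i) (binomChain (b ∷ r) n) ⟩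
  ((i + n) C i) * binomChain (a ∷ b ∷ r) n        ∎
  where chain = binomChain (shift i (b ∷ r)) (i + n)

binomChain-cons-shift : ∀ i L n → binomChain (i ∷ shift i L) (i + n) ≡ ((i + n) C i) * binomChain L n
binomChain-cons-shift i []      n = sym (*-identityʳ ((i + n) C i))
binomChain-cons-shift i (a ∷ L) n = binomChain-shift i a L n

gapProd-shift : ∀ X i p L n → gapProd X (i + p) (shift i L) (i + n) ≡ gapProd X p L n
gapProd-shift X i p []      n = cong (d X []) ([m+n]∸[m+o]≡n∸o i n p)
gapProd-shift X i p (a ∷ L) n =
  cong₂ _*_ (cong (d X []) ([m+n]∸[m+o]≡n∸o i a p)) (gapProd-shift X i a L n)

gapProd-cons-shift : ∀ X i L n → gapProd X 0 (i ∷ shift i L) (i + n) ≡ d X [] i * gapProd X 0 L n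
gapProd-cons-shift X i L n = cong (d X [] i *_) (begin
  gapProd X i (shift i L) (i + n)       ≡⟨ cong (λ p → gapProd X p (shift i L) (i + n)) (sym (+-identityʳ i)) ⟩
  gapProd X (i + 0) (shift i L) (i + n) ≡⟨ gapProd-shift X i 0 L n ⟩
  gapProd X 0 L n                       ∎)

sublists-map : ∀ (g : ℕ → ℕ) K → sublists (map g K) ≡ map (map g) (sublists K)
sublists-map g []      = refl
sublists-map g (x ∷ K) = begin
  map (g x ∷_) (sublists (map g K)) ++ sublists (map g K)
    ≡⟨ cong (λ S → map (g x ∷_) S ++ S) (sublists-map g K) ⟩
  map (g x ∷_) (map (map g) (sublists K)) ++ map (map g) (sublists K)
    ≡⟨ cong (_++ map (map g) (sublists K)) (trans (sym (map-∘ (sublists K))) (map-∘ (sublists K))) ⟩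
  map (map g) (map (x ∷_) (sublists K)) ++ map (map g) (sublists K)
    ≡⟨ sym (map-++ (map g) (map (x ∷_) (sublists K)) (sublists K)) ⟩
  map (map g) (sublists (x ∷ K)) ∎

sublists-length≤ : ∀ I → All (λ L → length L ≤ length I) (sublists I)
sublists-length≤ []      = z≤n ∷ []
sublists-length≤ (x ∷ I) = All.++⁺ (All.map⁺ (All.map s≤s (sublists-length≤ I)))
                                   (All.map m≤n⇒m≤1+n (sublists-length≤ I))

-- rhs X I n is, by definition, sumℤ (rhsTerm X (length I) n) (sublists I).
rhsTerm : Rel2 → ℕ → ℕ → List ℕ → ℤ
rhsTerm X k n L = (-1ℤ ℤ.^ (k ∸ length L)) ℤ.* + (binomChain L n * gapProd X 0 L n)

rhsTerm-suc : ∀ X k n L → length L ≤ k → rhsTerm X (suc k) n L ≡ - rhsTerm X k n L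
rhsTerm-suc X k n L L≤k = begin
  (-1ℤ ℤ.^ (suc k ∸ length L)) ℤ.* t        ≡⟨ cong (λ e → (-1ℤ ℤ.^ e) ℤ.* t) (+-∸-assoc 1 L≤k) ⟩
  (-1ℤ ℤ.* (-1ℤ ℤ.^ (k ∸ length L))) ℤ.* t  ≡⟨ ℤₚ.*-assoc -1ℤ (-1ℤ ℤ.^ (k ∸ length L)) t ⟩
  -1ℤ ℤ.* rhsTerm X k n L                   ≡⟨ ℤₚ.-1*i≡-i (rhsTerm X k n L) ⟩
  - rhsTerm X k n L                         ∎
  where t = + (binomChain L n * gapProd X 0 L n)

rhsTerm-cons-shift : ∀ X i K n L →
  rhsTerm X (suc (length (shift i K))) (i + n) (i ∷ shift i L) ≡ + (((i + n) C i) * d X [] i) ℤ.* rhsTerm X (length K) n L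
rhsTerm-cons-shift X i K n L = begin
  (-1ℤ ℤ.^ (length (shift i K) ∸ length (shift i L))) ℤ.*
    + (binomChain (i ∷ shift i L) (i + n) * gapProd X 0 (i ∷ shift i L) (i + n))
    ≡⟨ cong₂ (λ e b → (-1ℤ ℤ.^ e) ℤ.* + b) (cong₂ _∸_ (length-map (_+_ i) K) (length-map (_+_ i) L))
                                           (cong₂ _*_ (binomChain-cons-shift i L n) (gapProd-cons-shift X i L n)) ⟩
  sign ℤ.* + ((((i + n) C i) * binomChain L n) * (d X [] i * gapProd X 0 L n))
    ≡⟨ cong (λ b → sign ℤ.* + b) (ℕ*.interchange ((i + n) C i) (binomChain L n) (d X [] i) (gapProd X 0 L n)) ⟩
  sign ℤ.* + ((((i + n) C i) * d X [] i) * (binomChain L n * gapProd X 0 L n))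
    ≡⟨ cong (sign ℤ.*_) (ℤₚ.pos-* (((i + n) C i) * d X [] i) (binomChain L n * gapProd X 0 L n)) ⟩
  sign ℤ.* (+ (((i + n) C i) * d X [] i) ℤ.* + (binomChain L n * gapProd X 0 L n))
    ≡⟨ ℤ*.x∙yz≈y∙xz sign (+ (((i + n) C i) * d X [] i)) (+ (binomChain L n * gapProd X 0 L n)) ⟩
  + (((i + n) C i) * d X [] i) ℤ.* rhsTerm X (length K) n L ∎
  where sign = -1ℤ ℤ.^ (length K ∸ length L)

rhs-cons-shift : ∀ X i K n →
  rhs X (i ∷ shift i K) (i + n) ≡ + (((i + n) C i) * d X [] i) ℤ.* rhs X K n ℤ.- rhs X (shift i K) (i + n)
rhs-cons-shift X i K n = begin
  sumℤ term (map (i ∷_) (sublists J) ++ sublists J)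
    ≡⟨ sumℤ-++ term (map (i ∷_) (sublists J)) (sublists J) ⟩
  sumℤ term (map (i ∷_) (sublists J)) ℤ.+ sumℤ term (sublists J)
    ≡⟨ cong₂ ℤ._+_ withHead withoutHead ⟩
  c ℤ.* rhs X K n ℤ.- rhs X J (i + n) ∎
  where
  J = shift i K
  term = rhsTerm X (suc (length J)) (i + n)
  c = + (((i + n) C i) * d X [] i)
  withHead : sumℤ term (map (i ∷_) (sublists J)) ≡ c ℤ.* rhs X K n
  withHead = begin
    sumℤ term (map (i ∷_) (sublists J))
      ≡⟨ cong (sumℤ term ∘ map (i ∷_)) (sublists-map (_+_ i) K) ⟩
    sumℤ term (map (i ∷_) (map (shift i) (sublists K)))
      ≡⟨ trans (sumℤ-map term (i ∷_) (map (shift i) (sublists K))) (sumℤ-map (term ∘ (i ∷_)) (shift i) (sublists K)) ⟩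
    sumℤ (λ L → term (i ∷ shift i L)) (sublists K)
      ≡⟨ sumℤ-cong (All.universal (rhsTerm-cons-shift X i K n) (sublists K)) ⟩
    sumℤ (λ L → c ℤ.* rhsTerm X (length K) n L) (sublists K)
      ≡⟨ sumℤ-*ˡ c (rhsTerm X (length K) n) (sublists K) ⟩
    c ℤ.* rhs X K n ∎
  withoutHead : sumℤ term (sublists J) ≡ - rhs X J (i + n)
  withoutHead = trans (sumℤ-cong (All.map (λ {L} → rhsTerm-suc X (length J) (i + n) L) (sublists-length≤ J)))
                      (sumℤ-neg (rhsTerm X (length J) (i + n)) (sublists J))

-- Induction on the number of descents

shift-∸ : ∀ i I → All (i ≤_) I → shift i (map (_∸ i) I) ≡ I
shift-∸ i []      []             = refl
shift-∸ i (x ∷ I) (i≤x ∷ i≤I) = cong₂ _∷_ (m+[n∸m]≡n i≤x) (shift-∸ i I i≤I)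

Linked-<-∸ : ∀ i I → All (i ≤_) I → Linked _<_ I → Linked _<_ (map (_∸ i) I)
Linked-<-∸ i []          _ _ = []
Linked-<-∸ i (x ∷ [])    _ _ = [-]
Linked-<-∸ i (x ∷ y ∷ I) (i≤x ∷ i≤y ∷ i≤I) (x<y ∷ y<I) =
  ∸-monoˡ-< x<y i≤x ∷ Linked-<-∸ i (y ∷ I) (i≤y ∷ i≤I) y<I

All-∸-bounds : ∀ i n I → All (i <_) I → All (λ a → 1 ≤ a × a < i + n) I →
  All (λ k → 1 ≤ k × k < n) (map (_∸ i) I)
All-∸-bounds i n []      []            []                 = []
All-∸-bounds i n (x ∷ I) (i<x ∷ i<I) ((_ , x<i+n) ∷ I<) =
  (m<n⇒0<n∸m i<x , subst (x ∸ i <_) (m+n∸m≡n i n) (∸-monoˡ-< x<i+n (<⇒≤ i<x))) ∷ All-∸-bounds i n I i<I I<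

<⇒≡+suc : ∀ {i n} → i < n → ∃[ m ] n ≡ i + suc m
<⇒≡+suc {i} i<n with m≤n⇒∃[o]m+o≡n i<n
... | m , refl = m , sym (+-suc i m)

-- K = I' ∸ i is not a subterm of I = i ∷ I', hence the recursion on |I|.
theorem-by-length : ∀ X → StdInv X → ∀ m n I → length I ≡ m → Linked _<_ I → All (λ i → 1 ≤ i × i < n) I →
  + d X I n ≡ rhs X I n
theorem-by-length X std m n [] _ _ _ =
  sym (trans (ℤₚ.+-identityʳ _) (trans (ℤₚ.*-identityˡ _) (cong +_ (+-identityʳ (d X [] n)))))
theorem-by-length X std (suc m) n (suc i' ∷ I') |I|≡ linked ((_ , i<n) ∷ I'-bounds) with <⇒≡+suc i<n
... | n' , refl = subst (λ J → + d X (i ∷ J) N ≡ rhs X (i ∷ J) N) shift-K≡I' (begin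
  + d X (i ∷ shift i K) N                              ≡⟨ +d-cons-shift X std i' n' K (All.map proj₁ K-bounds) ⟩
  c ℤ.* + d X K (suc n') ℤ.- + d X (shift i K) N       ≡⟨ cong₂ (λ p q → c ℤ.* p ℤ.- q) ih-K ih-shift-K ⟩
  c ℤ.* rhs X K (suc n') ℤ.- rhs X (shift i K) N       ≡⟨ sym (rhs-cons-shift X i K (suc n')) ⟩
  rhs X (i ∷ shift i K) N                              ∎)
  where
  i = suc i'
  N = i + suc n'
  c = + ((N C i) * d X [] i)
  i<I' : All (i <_) I'
  i<I' = AllPairs.head (Linked⇒AllPairs <-trans linked)
  K = map (_∸ i) I'
  shift-K≡I' : shift i K ≡ I'
  shift-K≡I' = shift-∸ i I' (All.map <⇒≤ i<I')
  K-bounds : All (λ k → 1 ≤ k × k < suc n') K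
  K-bounds = All-∸-bounds i (suc n') I' i<I' I'-bounds
  ih-K : + d X K (suc n') ≡ rhs X K (suc n')
  ih-K = theorem-by-length X std m (suc n') K (trans (length-map (_∸ i) I') (suc-injective |I|≡))
                          (Linked-<-∸ i I' (All.map <⇒≤ i<I') (Linked.tail linked)) K-bounds
  ih-shift-K : + d X (shift i K) N ≡ rhs X (shift i K) N
  ih-shift-K = subst (λ J → + d X J N ≡ rhs X J N) (sym shift-K≡I')
                     (theorem-by-length X std m N I' (suc-injective |I|≡) (Linked.tail linked) I'-bounds)

theorem2p3 : (X : Rel2) → StdInv X → (n : ℕ) (I : List ℕ) →
  Linked _<_ I → All (λ i → 1 ≤ i × i < n) I →
  + d X I n ≡ rhs X I n
theorem2p3 X std n I = theorem-by-length X std (length I) n I refl
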